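{- Let $1<c\le 2$ and let $\mathcal T$ be a set of difference equalities with $|\mathcal T|<1/(2-c)$ (no restriction if $c=2$). If $\mathcal T$ is $c$-good, then $\mathcal T$ is $2$-good.
   Context: All linear equations are over $\mathbb Q$ in variables $x_1,\dots,x_k$, considered up to rearrangement but not scaling; the content of an equation is an expression $*$ with the equation reading $*=0$. Equations are independent if their contents are linearly independent; a collection implies an equation if its content is a $\mathbb Q$-linear combination of the contents of the collection. An equation contains a variable if its coefficient is nonzero. A difference equality is a nontrivial equation $x_{i_1}-x_{i_2}=x_{i_3}-x_{i_4}$ ($i_1,\dots,i_4\in[k]$ not necessarily distinct). A collection is valid if it does not imply $x_a=x_b$ for $a\ne b$; collinearity-free if it implies no equation containing exactly three variables; for $1<c\le2$, $c$-light if for every $t\ge1$ any $t$ independent equations it implies together contain at least $ct+1$ variables; $c$-good if valid, collinearity-free and $c$-light.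
   Formalization: The parameter c ranges over the rationals. -}

module Defs where

open import Data.Nat using (ℕ; zero; suc; _≥_)
open import Data.Bool using (Bool; true; false; if_then_else_)
open import Data.Fin using (Fin; zero; suc)
import Data.Fin.Properties as FinP
open import Data.Integer using (+_)
open import Data.Rational using (ℚ; 0ℚ; 1ℚ; _+_; _-_; _*_; -_; _≤_; _/_)
open import Data.Rational.Properties using (_≟_)
open import Data.List using (List; length; lookup)
open import Data.Product using (_×_; _,_; ∃)
open import Relation.Binary.PropositionalEquality using (_≡_)
open import Relation.Nullary using (¬_; does; ¬?)

ℕ→ℚ : ℕ → ℚ
ℕ→ℚ n = + n / 1

Σ : ∀ {n} → (Fin n → ℚ) → ℚ
Σ {zero}  f = 0ℚ
Σ {suc n} f = f zero + Σ (λ i → f (suc i))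

count : ∀ {n} → (Fin n → Bool) → ℕ
count {zero}  p = 0
count {suc n} p = (if p zero then 1 else 0) Data.Nat.+ count (λ i → p (suc i))

-- content of a homogeneous linear equation in x_1..x_k: coefficient vector
Form : ℕ → Set
Form k = Fin k → ℚ

zeroForm : ∀ {k} → Form k → Set
zeroForm e = ∀ j → e j ≡ 0ℚ

δ : ∀ {k} → Fin k → Form k
δ a j = if does (a FinP.≟ j) then 1ℚ else 0ℚ

-- a difference equality  x_{i1} - x_{i2} = x_{i3} - x_{i4}, stored by its indices
Quad : ℕ → Set
Quad k = Fin k × Fin k × Fin k × Fin k

content : ∀ {k} → Quad k → Form k
content (a , b , c , d) j = ((δ a j - δ b j) - δ c j) + δ d j

-- the content of the equation x_a = x_b
diff : ∀ {k} → Fin k → Fin k → Form k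
diff a b j = δ a j - δ b j

-- a finite SET of difference equalities: each nontrivial, pairwise distinct
-- as equations (equations are identified up to rearrangement, i.e. content up to sign)
IsDiffEqSet : ∀ {k} → List (Quad k) → Set
IsDiffEqSet {k} T =
  (∀ i → ¬ zeroForm (content (lookup T i))) ×
  (∀ i i′ → ¬ i ≡ i′ →
     ¬ (∀ j → content (lookup T i) j ≡ content (lookup T i′) j) ×
     ¬ (∀ j → content (lookup T i) j ≡ - content (lookup T i′) j))

Implies : ∀ {k} → List (Quad k) → Form k → Set
Implies T e = ∃ λ (λs : Fin (length T) → ℚ) →
  ∀ j → e j ≡ Σ (λ i → λs i * content (lookup T i) j)

Independent : ∀ {k t} → (Fin t → Form k) → Set
Independent {k} {t} E = ∀ (μ : Fin t → ℚ) →
  (∀ j → Σ (λ i → μ i * E i j) ≡ 0ℚ) → ∀ i → μ i ≡ 0ℚ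

numVars : ∀ {k t} → (Fin t → Form k) → ℕ
numVars {k} {t} E = count (λ j → does (FinP.any? (λ i → ¬? (E i j ≟ 0ℚ))))

numVars₁ : ∀ {k} → Form k → ℕ
numVars₁ e = numVars {t = 1} (λ _ → e)

Valid : ∀ {k} → List (Quad k) → Set
Valid {k} T = ∀ (a b : Fin k) → ¬ a ≡ b → ¬ Implies T (diff a b)

CollinearityFree : ∀ {k} → List (Quad k) → Set
CollinearityFree {k} T = ∀ (e : Form k) → Implies T e → ¬ numVars₁ e ≡ 3

Light : ∀ {k} → ℚ → List (Quad k) → Set
Light {k} c T = ∀ (t : ℕ) → t ≥ 1 → (E : Fin t → Form k) →
  (∀ i → Implies T (E i)) → Independent E →
  c * ℕ→ℚ t + 1ℚ ≤ ℕ→ℚ (numVars E)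

Good : ∀ {k} → ℚ → List (Quad k) → Set
Good c T = Valid T × CollinearityFree T × Light c T

{-# OPTIONS --safe #-}
-- If T implies t independent equations, their coefficient vectors with respect to the
-- contents of T are independent in ℚ^|T|, so Gaussian elimination gives t ≤ |T| and hence
-- t (2 - c) < 1. The c-light bound n ≥ ct + 1 on the number n of variables then yields
-- n > 2t, i.e. n ≥ 2t + 1 since n is an integer. Validity and collinearity-freeness do not
-- involve c.
module Submission where

open import Algebra.Bundles using (CommutativeRing)
open import Data.Fin using (Fin; zero; suc; punchIn)
import Data.Fin.Properties as FinP
import Data.Integer as ℤ
import Data.Integer.Properties as ℤP
open import Data.List using (List; length; lookup)
open import Data.Nat as ℕ using (ℕ; zero; suc; z≤n; s≤s)
import Data.Nat.Properties as ℕP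
open import Data.Product using (_,_; proj₁; proj₂)
open import Data.Rational
  using (ℚ; 0ℚ; 1ℚ; _+_; _-_; _*_; -_; _≤_; _<_; 1/_; toℚᵘ; NonZero; ≢-nonZero; NonNegative; nonNegative)
open import Data.Rational.Literals using (fromℤ)
import Data.Rational.Properties as ℚP
open import Data.Rational.Solver using (module +-*-Solver)
import Data.Rational.Unnormalised as ℚᵘ
import Data.Rational.Unnormalised.Properties as ℚᵘP
open import Data.Vec.Functional using (insertAt)
open import Data.Vec.Functional.Properties using (insertAt-lookup; insertAt-punchIn)
open import Relation.Binary.PropositionalEquality
open import Relation.Nullary using (yes; no; ¬?; contradiction)
open import Relation.Nullary.Decidable using (decidable-stable)
open import Algebra.Properties.Semiring.Sum (CommutativeRing.semiring ℚP.+-*-commutativeRing)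
  using (sum; sum-cong-≗; sum-replicate-zero; sum-remove; ∑-distrib-+; ∑-comm; *-distribˡ-sum; *-distribʳ-sum)

open import Defs

open +-*-Solver

Σ≡sum : ∀ {n} (f : Fin n → ℚ) → Σ f ≡ sum f
Σ≡sum {zero}  f = refl
Σ≡sum {suc n} f = cong (f zero +_) (Σ≡sum (λ i → f (suc i)))

Σ-cong : ∀ {n} {f g : Fin n → ℚ} → (∀ i → f i ≡ g i) → Σ f ≡ Σ g
Σ-cong {f = f} {g} f≗g = trans (Σ≡sum f) (trans (sum-cong-≗ f≗g) (sym (Σ≡sum g)))

Σ-zero : ∀ {n} {f : Fin n → ℚ} → (∀ i → f i ≡ 0ℚ) → Σ f ≡ 0ℚ
Σ-zero {n} f≗0 = trans (Σ-cong f≗0) (trans (Σ≡sum {n} (λ _ → 0ℚ)) (sum-replicate-zero n))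

Σ-distrib-+ : ∀ {n} (f g : Fin n → ℚ) → Σ (λ i → f i + g i) ≡ Σ f + Σ g
Σ-distrib-+ f g =
  trans (Σ≡sum (λ i → f i + g i)) (trans (∑-distrib-+ f g) (sym (cong₂ _+_ (Σ≡sum f) (Σ≡sum g))))

*-distribˡ-Σ : ∀ {n} (a : ℚ) (f : Fin n → ℚ) → a * Σ f ≡ Σ (λ i → a * f i)
*-distribˡ-Σ a f = trans (cong (a *_) (Σ≡sum f)) (trans (*-distribˡ-sum a f) (sym (Σ≡sum (λ i → a * f i))))

*-distribʳ-Σ : ∀ {n} (a : ℚ) (f : Fin n → ℚ) → Σ f * a ≡ Σ (λ i → f i * a)
*-distribʳ-Σ a f = trans (cong (_* a) (Σ≡sum f)) (trans (*-distribʳ-sum a f) (sym (Σ≡sum (λ i → f i * a))))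

Σ-comm : ∀ {n m} (F : Fin n → Fin m → ℚ) →
  Σ (λ i → Σ (λ l → F i l)) ≡ Σ (λ l → Σ (λ i → F i l))
Σ-comm F = begin
  Σ (λ i → Σ (F i))                   ≡⟨ Σ≡sum (λ i → Σ (F i)) ⟩
  sum (λ i → Σ (F i))                 ≡⟨ sum-cong-≗ (λ i → Σ≡sum (F i)) ⟩
  sum (λ i → sum (F i))               ≡⟨ ∑-comm F ⟩
  sum (λ l → sum (λ i → F i l))       ≡⟨ sum-cong-≗ (λ l → sym (Σ≡sum (λ i → F i l))) ⟩
  sum (λ l → Σ (λ i → F i l))         ≡⟨ Σ≡sum (λ l → Σ (λ i → F i l)) ⟨
  Σ (λ l → Σ (λ i → F i l))           ∎
  where open ≡-Reasoning

Σ-punchIn : ∀ {n} (p : Fin (suc n)) (f : Fin (suc n) → ℚ) → Σ f ≡ f p + Σ (λ i → f (punchIn p i))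
Σ-punchIn p f = trans (Σ≡sum f) (trans (sum-remove f) (cong (f p +_) (sym (Σ≡sum (λ i → f (punchIn p i))))))

linComb : ∀ {t k} → (Fin t → ℚ) → (Fin t → Form k) → Form k
linComb μ E j = Σ (λ i → μ i * E i j)

linComb-assoc : ∀ {t m k} (μ : Fin t → ℚ) (A : Fin t → Fin m → ℚ) (C : Fin m → Form k) j →
  linComb μ (λ i → linComb (A i) C) j ≡ linComb (linComb μ A) C j
linComb-assoc μ A C j = begin
  Σ (λ i → μ i * Σ (λ l → A i l * C l j))    ≡⟨ Σ-cong (λ i → *-distribˡ-Σ (μ i) (λ l → A i l * C l j)) ⟩
  Σ (λ i → Σ (λ l → μ i * (A i l * C l j)))  ≡⟨ Σ-comm (λ i l → μ i * (A i l * C l j)) ⟩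
  Σ (λ l → Σ (λ i → μ i * (A i l * C l j)))  ≡⟨ Σ-cong (λ l → Σ-cong (λ i → sym (ℚP.*-assoc (μ i) (A i l) (C l j)))) ⟩
  Σ (λ l → Σ (λ i → (μ i * A i l) * C l j))  ≡⟨ Σ-cong (λ l → sym (*-distribʳ-Σ (C l j) (λ i → μ i * A i l))) ⟩
  Σ (λ l → Σ (λ i → μ i * A i l) * C l j)    ∎
  where open ≡-Reasoning

independent-factor : ∀ {t m k} (E : Fin t → Form k) (A : Fin t → Fin m → ℚ) (C : Fin m → Form k) →
  (∀ i j → E i j ≡ linComb (A i) C j) → Independent E → Independent A
independent-factor E A C E≡AC indep μ μA≡0 = indep μ μE≡0
  where
  μE≡0 : ∀ j → linComb μ E j ≡ 0ℚ
  μE≡0 j = begin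
    linComb μ E j                            ≡⟨ Σ-cong (λ i → cong (μ i *_) (E≡AC i j)) ⟩
    linComb μ (λ i → linComb (A i) C) j      ≡⟨ linComb-assoc μ A C j ⟩
    linComb (linComb μ A) C j                ≡⟨ Σ-zero (λ l → trans (cong (_* C l j) (μA≡0 l)) (ℚP.*-zeroˡ (C l j))) ⟩
    0ℚ                                       ∎
    where open ≡-Reasoning

independent-dropZeroColumn : ∀ {t m} (A : Fin t → Form (suc m)) →
  (∀ i → A i zero ≡ 0ℚ) → Independent A → Independent (λ i l → A i (suc l))
independent-dropZeroColumn A zeroColumn indep μ h = indep μ μA≡0
  where
  μA≡0 : ∀ l → linComb μ A l ≡ 0ℚ
  μA≡0 zero    = Σ-zero (λ i → trans (cong (μ i *_) (zeroColumn i)) (ℚP.*-zeroʳ (μ i)))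
  μA≡0 (suc l) = h l

-- r is meant to be the inverse of the pivot A p zero.
eliminate : ∀ {t m} → (Fin (suc t) → Form (suc m)) → Fin (suc t) → ℚ → Fin t → Form m
eliminate A p r i l = A (punchIn p i) (suc l) - A (punchIn p i) zero * (r * A p (suc l))

linComb-sub-scaled : ∀ {n} (ν x y : Fin n → ℚ) (s : ℚ) →
  Σ (λ i → ν i * (x i - y i * s)) ≡ Σ (λ i → ν i * x i) - Σ (λ i → ν i * y i) * s
linComb-sub-scaled ν x y s = begin
  Σ (λ i → ν i * (x i - y i * s))               ≡⟨ Σ-cong (λ i → expand (ν i) (x i) (y i) s) ⟩
  Σ (λ i → ν i * x i + (- s) * (ν i * y i))     ≡⟨ Σ-distrib-+ (λ i → ν i * x i) (λ i → (- s) * (ν i * y i)) ⟩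
  X + Σ (λ i → (- s) * (ν i * y i))             ≡⟨ cong (X +_) (*-distribˡ-Σ (- s) (λ i → ν i * y i)) ⟨
  X + (- s) * Y                                 ≡⟨ solve 3 (λ X Y s → X :+ (:- s) :* Y := X :- Y :* s) refl X Y s ⟩
  X - Y * s                                     ∎
  where
  open ≡-Reasoning
  X Y : ℚ
  X = Σ (λ i → ν i * x i)
  Y = Σ (λ i → ν i * y i)
  expand : ∀ v a b s → v * (a - b * s) ≡ v * a + (- s) * (v * b)
  expand = solve 4 (λ v a b s → v :* (a :- b :* s) := v :* a :+ (:- s) :* (v :* b)) refl

independent-eliminate : ∀ {t m} (A : Fin (suc t) → Form (suc m)) (p : Fin (suc t)) (r : ℚ) →
  r * A p zero ≡ 1ℚ → Independent A → Independent (eliminate A p r)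
-- The pivot-row coefficient μₚ of the lifted relation μ is chosen to cancel column zero.
independent-eliminate {t} {m} A p r r*a≡1 indep ν νB≡0 i =
  trans (sym (insertAt-punchIn ν p μₚ i)) (indep μ μA≡0 (punchIn p i))
  where
  A′ : Fin t → Form (suc m)
  A′ i = A (punchIn p i)
  S₀ μₚ : ℚ
  S₀ = linComb ν A′ zero
  μₚ = - S₀ * r
  μ : Fin (suc t) → ℚ
  μ = insertAt ν p μₚ
  μA≡ : ∀ l → linComb μ A l ≡ μₚ * A p l + linComb ν A′ l
  μA≡ l = trans (Σ-punchIn p (λ i → μ i * A i l))
    (cong₂ _+_ (cong (_* A p l) (insertAt-lookup ν p μₚ))
               (Σ-cong (λ i → cong (_* A′ i l) (insertAt-punchIn ν p μₚ i))))
  μA≡0 : ∀ l → linComb μ A l ≡ 0ℚ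
  μA≡0 zero = begin
    linComb μ A zero              ≡⟨ μA≡ zero ⟩
    (- S₀ * r) * A p zero + S₀    ≡⟨ cong (_+ S₀) (ℚP.*-assoc (- S₀) r (A p zero)) ⟩
    - S₀ * (r * A p zero) + S₀    ≡⟨ cong (λ x → - S₀ * x + S₀) r*a≡1 ⟩
    - S₀ * 1ℚ + S₀                ≡⟨ solve 1 (λ s → (:- s) :* con 1ℚ :+ s := con 0ℚ) refl S₀ ⟩
    0ℚ                            ∎
    where open ≡-Reasoning
  μA≡0 (suc l) = begin
    linComb μ A (suc l)                       ≡⟨ μA≡ (suc l) ⟩
    (- S₀ * r) * P + X                        ≡⟨ solve 4 (λ s r P X → (:- s :* r) :* P :+ X := X :- s :* (r :* P)) refl S₀ r P X ⟩
    X - S₀ * (r * P)                          ≡⟨ linComb-sub-scaled ν (λ i → A′ i (suc l)) (λ i → A′ i zero) (r * P) ⟨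
    linComb ν (eliminate A p r) l             ≡⟨ νB≡0 l ⟩
    0ℚ                                        ∎
    where
    open ≡-Reasoning
    P X : ℚ
    P = A p (suc l)
    X = linComb ν A′ (suc l)

independent⇒≤ : ∀ {t m} (A : Fin t → Form m) → Independent A → t ℕ.≤ m
independent⇒≤ {zero}          A indep = z≤n
independent⇒≤ {suc t} {zero}  A indep = contradiction (indep (λ _ → 1ℚ) (λ ()) zero) ℚP.1≢0
independent⇒≤ {suc t} {suc m} A indep with FinP.any? (λ i → ¬? (A i zero ℚP.≟ 0ℚ))
... | yes (p , a≢0) =
  s≤s (independent⇒≤ (eliminate A p r) (independent-eliminate A p r (ℚP.*-inverseˡ a) indep))
  where
  a r : ℚ
  a = A p zero
  instance
    a≢0′ : NonZero a
    a≢0′ = ≢-nonZero a≢0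
  r = 1/ a
... | no noPivot =
  ℕP.m≤n⇒m≤1+n (independent⇒≤ (λ i l → A i (suc l)) (independent-dropZeroColumn A zeroColumn indep))
  where
  zeroColumn : ∀ i → A i zero ≡ 0ℚ
  zeroColumn i = decidable-stable (A i zero ℚP.≟ 0ℚ) (λ a≢0 → noPivot (i , a≢0))

implied-independent⇒≤length : ∀ {k t} (T : List (Quad k)) (E : Fin t → Form k) →
  (∀ i → Implies T (E i)) → Independent E → t ℕ.≤ length T
implied-independent⇒≤length {t = t} T E implied indep = independent⇒≤ A
  (independent-factor E A (λ l → content (lookup T l)) (λ i → proj₂ (implied i)) indep)
  where
  A : Fin t → Form (length T)
  A i = proj₁ (implied i)

toℚᵘ-ℕ→ℚ : ∀ n → toℚᵘ (ℕ→ℚ n) ≡ ℚᵘ.mkℚᵘ (ℤ.+ n) 0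
toℚᵘ-ℕ→ℚ n = cong toℚᵘ (ℚP.↥p/↧p≡p (fromℤ (ℤ.+ n)))

ℕ→ℚ-homo-+ : ∀ a b → ℕ→ℚ (a ℕ.+ b) ≡ ℕ→ℚ a + ℕ→ℚ b
ℕ→ℚ-homo-+ a b = ℚP.toℚᵘ-injective (begin
  toℚᵘ (ℕ→ℚ (a ℕ.+ b))                       ≡⟨ toℚᵘ-ℕ→ℚ (a ℕ.+ b) ⟩
  ℚᵘ.mkℚᵘ (ℤ.+ (a ℕ.+ b)) 0                  ≈⟨ ℚᵘ.*≡* (cong (ℤ._* ℤ.1ℤ) (sym (cong₂ ℤ._+_ a*1≡a b*1≡b))) ⟩
  ℚᵘ.mkℚᵘ (ℤ.+ a) 0 ℚᵘ.+ ℚᵘ.mkℚᵘ (ℤ.+ b) 0   ≡⟨ cong₂ ℚᵘ._+_ (toℚᵘ-ℕ→ℚ a) (toℚᵘ-ℕ→ℚ b) ⟨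
  toℚᵘ (ℕ→ℚ a) ℚᵘ.+ toℚᵘ (ℕ→ℚ b)             ≈⟨ ℚP.toℚᵘ-homo-+ (ℕ→ℚ a) (ℕ→ℚ b) ⟨
  toℚᵘ (ℕ→ℚ a + ℕ→ℚ b)                       ∎)
  where
  open ℚᵘP.≃-Reasoning
  a*1≡a : ℤ.+ a ℤ.* ℤ.1ℤ ≡ ℤ.+ a
  a*1≡a = ℤP.*-identityʳ (ℤ.+ a)
  b*1≡b : ℤ.+ b ℤ.* ℤ.1ℤ ≡ ℤ.+ b
  b*1≡b = ℤP.*-identityʳ (ℤ.+ b)

ℕ→ℚ-homo-* : ∀ a b → ℕ→ℚ (a ℕ.* b) ≡ ℕ→ℚ a * ℕ→ℚ b
ℕ→ℚ-homo-* zero    b = sym (ℚP.*-zeroˡ (ℕ→ℚ b))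
ℕ→ℚ-homo-* (suc a) b = begin
  ℕ→ℚ (b ℕ.+ a ℕ.* b)           ≡⟨ ℕ→ℚ-homo-+ b (a ℕ.* b) ⟩
  ℕ→ℚ b + ℕ→ℚ (a ℕ.* b)         ≡⟨ cong (ℕ→ℚ b +_) (ℕ→ℚ-homo-* a b) ⟩
  ℕ→ℚ b + ℕ→ℚ a * ℕ→ℚ b         ≡⟨ solve 2 (λ x y → y :+ x :* y := (con 1ℚ :+ x) :* y) refl (ℕ→ℚ a) (ℕ→ℚ b) ⟩
  (1ℚ + ℕ→ℚ a) * ℕ→ℚ b          ≡⟨ cong (_* ℕ→ℚ b) (ℕ→ℚ-homo-+ 1 a) ⟨
  ℕ→ℚ (suc a) * ℕ→ℚ b           ∎
  where open ≡-Reasoning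

ℕ→ℚ-mono-≤ : ∀ {a b} → a ℕ.≤ b → ℕ→ℚ a ≤ ℕ→ℚ b
ℕ→ℚ-mono-≤ {a} {b} a≤b = ℚP.toℚᵘ-cancel-≤
  (subst₂ ℚᵘ._≤_ (sym (toℚᵘ-ℕ→ℚ a)) (sym (toℚᵘ-ℕ→ℚ b))
    (ℚᵘ.*≤* (ℤP.*-monoʳ-≤-nonNeg ℤ.1ℤ (ℤ.+≤+ a≤b))))

ℕ→ℚ-cancel-< : ∀ {a b} → ℕ→ℚ a < ℕ→ℚ b → a ℕ.< b
ℕ→ℚ-cancel-< a<b = ℕP.≰⇒> (λ b≤a → ℚP.<-irrefl refl (ℚP.<-≤-trans a<b (ℕ→ℚ-mono-≤ b≤a)))

-- Integrality of n turns 2t < ct + 1 ≤ n into 2t + 1 ≤ n.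
light-sharpen : ∀ (c : ℚ) (t n : ℕ) → c * ℕ→ℚ t + 1ℚ ≤ ℕ→ℚ n → ℕ→ℚ t * (ℕ→ℚ 2 - c) < 1ℚ →
  ℕ→ℚ 2 * ℕ→ℚ t + 1ℚ ≤ ℕ→ℚ n
light-sharpen c t n ct+1≤n t[2-c]<1 = begin
  ℕ→ℚ 2 * ℕ→ℚ t + 1ℚ       ≡⟨ ℚP.+-comm (ℕ→ℚ 2 * ℕ→ℚ t) 1ℚ ⟩
  1ℚ + ℕ→ℚ 2 * ℕ→ℚ t       ≡⟨ trans (ℕ→ℚ-homo-+ 1 (2 ℕ.* t)) (cong (1ℚ +_) (ℕ→ℚ-homo-* 2 t)) ⟨
  ℕ→ℚ (suc (2 ℕ.* t))      ≤⟨ ℕ→ℚ-mono-≤ 2t<n ⟩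
  ℕ→ℚ n                    ∎
  where
  open ℚP.≤-Reasoning
  2t<n : 2 ℕ.* t ℕ.< n
  2t<n = ℕ→ℚ-cancel-< (begin-strict
    ℕ→ℚ (2 ℕ.* t)                           ≡⟨ ℕ→ℚ-homo-* 2 t ⟩
    ℕ→ℚ 2 * ℕ→ℚ t                           ≡⟨ solve 3 (λ w c τ → w :* τ := c :* τ :+ τ :* (w :- c)) refl (ℕ→ℚ 2) c (ℕ→ℚ t) ⟩
    c * ℕ→ℚ t + ℕ→ℚ t * (ℕ→ℚ 2 - c)         <⟨ ℚP.+-monoʳ-< (c * ℕ→ℚ t) t[2-c]<1 ⟩
    c * ℕ→ℚ t + 1ℚ                          ≤⟨ ct+1≤n ⟩
    ℕ→ℚ n                                   ∎)

claim5p1 : (k : ℕ) (c : ℚ) → 1ℚ < c → c ≤ ℕ→ℚ 2 →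
    (T : List (Quad k)) → IsDiffEqSet T →
    ℕ→ℚ (length T) * (ℕ→ℚ 2 - c) < 1ℚ →
    Good c T → Good (ℕ→ℚ 2) T
claim5p1 k c _ c≤2 T _ |T|[2-c]<1 (valid , collinearityFree , c-light) =
  valid , collinearityFree , 2-light
  where
  instance
    2-c≥0 : NonNegative (ℕ→ℚ 2 - c)
    2-c≥0 = nonNegative (subst (_≤ ℕ→ℚ 2 - c) (ℚP.+-inverseʳ c) (ℚP.+-monoˡ-≤ (- c) c≤2))

  2-light : Light (ℕ→ℚ 2) T
  2-light t t≥1 E implied indep = light-sharpen c t (numVars E) (c-light t t≥1 E implied indep) t[2-c]<1
    where
    t≤|T| : t ℕ.≤ length T
    t≤|T| = implied-independent⇒≤length T E implied indep
    t[2-c]<1 : ℕ→ℚ t * (ℕ→ℚ 2 - c) < 1ℚ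
    t[2-c]<1 = ℚP.≤-<-trans (ℚP.*-monoʳ-≤-nonNeg (ℕ→ℚ 2 - c) (ℕ→ℚ-mono-≤ t≤|T|)) |T|[2-c]<1
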